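{- Let $d\geq 1$ and $k\geq 1$ be integers and let $\mathcal L_{d,k}$ be a level-symmetric tree. Then $\mathcal L_{d,k}$ satisfies the neighbour sum property if and only if $d=1$ and $k\equiv 1 \pmod 3$.
   Context: A finite tree $\mathcal L_{d,k}$ is called level-symmetric if there is a vertex $v_0$ such that (1) $v_0$ has degree $d\geq 1$ and every other vertex has degree $d+1$ or $1$, and (2) every path starting at $v_0$ and ending at a leaf has length $k$. A graph $\mathcal G=(\mathcal V,\mathcal E)$ satisfies the neighbour sum property if there exists $f:\mathcal V\to\mathbb R$ with $f\not\equiv 0$ such that $f(x)=\sum_{y:\{x,y\}\in\mathcal E} f(y)$ for every $x\in\mathcal V$.
   Formalization: In the neighbour sum property the function f takes only rational values instead of values in ℝ. -}

module Defs where

open import Data.Nat using (ℕ; zero; suc; _≤_; _<_; _<?_; s≤s)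
open import Data.Nat.Properties using (<⇒≤)
open import Data.Fin using (Fin)
open import Data.List using (List; []; _∷_; length; map; foldr; allFin; _++_)
open import Data.Product using (Σ; Σ-syntax; ∃; _×_; _,_)
open import Data.Rational using (ℚ; 0ℚ; _+_)
open import Relation.Binary.PropositionalEquality using (_≡_; _≢_)
open import Relation.Nullary using (yes; no)

-- A finite graph given by its vertex type and, for each vertex x,
-- the list of its neighbours (each neighbour y with {x,y} ∈ E listed once).
record Graph : Set₁ where
  field
    V          : Set
    neighbours : V → List V
open Graph public

sumℚ : List ℚ → ℚ
sumℚ = foldr _+_ 0ℚ

NeighbourSumProperty : Graph → Set
NeighbourSumProperty G =
  Σ[ f ∈ (V G → ℚ) ]
    (Σ[ x ∈ V G ] f x ≢ 0ℚ) × (∀ x → f x ≡ sumℚ (map f (neighbours G x)))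

-- Level-symmetric tree L_{d,k}: vertices are the words over the alphabet
-- Fin d of length ≤ k (the empty word is the root v₀). The word (i ∷ w)
-- is a child of w. Hence the root has d children (degree d), every inner
-- vertex has 1 parent and d children (degree d+1), the words of length k
-- are leaves (degree 1), and every root-to-leaf path has length k.
LVertex : ℕ → ℕ → Set
LVertex d k = Σ[ w ∈ List (Fin d) ] length w ≤ k

LParent : ∀ {d k} → LVertex d k → List (LVertex d k)
LParent ([] , _) = []
LParent (i ∷ w , s≤s p) = (w , <⇒≤ (s≤s p)) ∷ []

LChildren : ∀ {d k} → LVertex d k → List (LVertex d k)
LChildren {d} {k} (w , _) with length w <? k
... | yes q = map (λ i → (i ∷ w , q)) (allFin d)
... | no _  = []

LevelSymmetricTree : ℕ → ℕ → Graph
LevelSymmetricTree d k = record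
  { V = LVertex d k
  ; neighbours = λ x → LParent x ++ LChildren x }

-- If f solves the neighbour-sum equations, a vertex v at height h (distance to the leaves)
-- satisfies P(h+1) f(v) = P(h) f(parent v), where P(0) = P(1) = 1 and
-- P(h+2) = P(h+1) - d P(h): induct upwards from the leaves, summing the relation over the
-- d children of v. The root has no parent, so P(k+1) f(root) = 0. Since P(h) ≡ 1 (mod d),
-- for d ≥ 2 no P(h) vanishes, and f is forced to be 0 from the root downwards.
-- For d = 1 the tree is a path v_0, …, v_k and f(v_n) = profile(n) f(v_0) for the 6-periodic
-- profile = 1, 1, 0, -1, -1, 0, …; the leaf equation profile(k) = profile(k-1) holds iff
-- k ≡ 1 (mod 3), and then profile itself is a solution.
module Submission where

open import Defs
open import Data.Empty using (⊥-elim)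
open import Data.Fin using (Fin; zero)
open import Data.Integer as ℤ using (ℤ; +_; 0ℤ; 1ℤ; -1ℤ; ∣_∣)
import Data.Integer.Properties as ℤ
open import Data.Integer.Tactic.RingSolver using (solve-∀)
open import Data.List using (List; []; _∷_; length; map; allFin; replicate)
open import Data.List.Properties using (map-∘; length-tabulate; length-replicate)
open import Data.Nat as ℕ using (ℕ; zero; suc; z≤n; s≤s; _≤_; _<_; _<?_; _∸_; _%_)
open import Data.Nat.Properties as ℕ
  using (≤-irrelevant; <-irrefl; <⇒≢; <⇒≤; ≤-reflexive; m≤m+n; +-suc; m+[n∸m]≡n; m≤n⇒m<n∨m≡n; m*n≡1⇒m≡1; suc-injective)
open import Data.Product using (Σ-syntax; _×_; _,_; proj₁; proj₂)
open import Data.Rational using (ℚ; 0ℚ; 1ℚ; _+_; _-_; _*_; -_; _/_; 1/_; toℚᵘ; ≢-nonZero)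
open import Data.Rational.Properties
  using (toℚᵘ-injective; toℚᵘ-fromℚᵘ; toℚᵘ-homo-+; toℚᵘ-homo-*; toℚᵘ-homo‿-; +-identityˡ; +-identityʳ; *-identityˡ; *-identityʳ; *-zeroˡ; *-zeroʳ; *-assoc; *-inverseˡ)
open import Data.Rational.Solver using (module +-*-Solver)
open import Data.Rational.Unnormalised as ℚᵘ using (mkℚᵘ; *≡*) renaming (_≃_ to _≃ᵘ_)
import Data.Rational.Unnormalised.Properties as ℚᵘ
open import Data.Sum using (inj₁; inj₂)
open import Function using (_∘_)
open import Function.Bundles using (_⇔_; mk⇔; module Equivalence)
open import Relation.Binary.PropositionalEquality using (_≡_; _≢_; refl; sym; trans; cong; cong₂; subst; module ≡-Reasoning)
open import Relation.Nullary using (¬_; yes; no; contradiction)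

open +-*-Solver using (solve; con; _:+_; _:-_; _:*_; _:=_)

fromℤ : ℤ → ℚ
fromℤ z = z / 1

toℚᵘ-fromℤ : ∀ z → toℚᵘ (fromℤ z) ≃ᵘ mkℚᵘ z 0
toℚᵘ-fromℤ z = toℚᵘ-fromℚᵘ (mkℚᵘ z 0)

fromℤ-via-ℚᵘ : ∀ z {q} → mkℚᵘ z 0 ≃ᵘ toℚᵘ q → fromℤ z ≡ q
fromℤ-via-ℚᵘ z e = toℚᵘ-injective (ℚᵘ.≃-trans (toℚᵘ-fromℤ z) e)

fromℤ-homo-+ : ∀ a b → fromℤ (a ℤ.+ b) ≡ fromℤ a + fromℤ b
fromℤ-homo-+ a b = fromℤ-via-ℚᵘ (a ℤ.+ b) (ℚᵘ.≃-trans (*≡* (identity a b)) (ℚᵘ.≃-sym (ℚᵘ.≃-trans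
  (toℚᵘ-homo-+ (fromℤ a) (fromℤ b)) (ℚᵘ.+-cong (toℚᵘ-fromℤ a) (toℚᵘ-fromℤ b)))))
  where
  identity : ∀ a b → (a ℤ.+ b) ℤ.* + 1 ≡ (a ℤ.* + 1 ℤ.+ b ℤ.* + 1) ℤ.* + 1
  identity = solve-∀

fromℤ-homo-* : ∀ a b → fromℤ (a ℤ.* b) ≡ fromℤ a * fromℤ b
fromℤ-homo-* a b = fromℤ-via-ℚᵘ (a ℤ.* b) (ℚᵘ.≃-sym (ℚᵘ.≃-trans
  (toℚᵘ-homo-* (fromℤ a) (fromℤ b)) (ℚᵘ.*-cong (toℚᵘ-fromℤ a) (toℚᵘ-fromℤ b))))

fromℤ-homo‿- : ∀ a → fromℤ (ℤ.- a) ≡ - fromℤ a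
fromℤ-homo‿- a = fromℤ-via-ℚᵘ (ℤ.- a) (ℚᵘ.≃-sym (ℚᵘ.≃-trans
  (toℚᵘ-homo‿- (fromℤ a)) (ℚᵘ.-‿cong (toℚᵘ-fromℤ a))))

fromℤ-injective : ∀ {a b} → fromℤ a ≡ fromℤ b → a ≡ b
fromℤ-injective {a} {b} e with ℚᵘ.≃-trans (ℚᵘ.≃-sym (toℚᵘ-fromℤ a))
                                 (ℚᵘ.≃-trans (ℚᵘ.≃-reflexive (cong toℚᵘ e)) (toℚᵘ-fromℤ b))
... | *≡* a*1≡b*1 = trans (sym (ℤ.*-identityʳ a)) (trans a*1≡b*1 (ℤ.*-identityʳ b))

*-cancelˡ-≡ : ∀ {p q r} → p ≢ 0ℚ → p * q ≡ p * r → q ≡ r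
*-cancelˡ-≡ {p} {q} {r} p≢0 e = trans (undo q) (trans (cong (1/ p *_) e) (sym (undo r)))
  where
  instance
    _ = ≢-nonZero p≢0
  open ≡-Reasoning
  undo : ∀ x → x ≡ 1/ p * (p * x)
  undo x = begin
    x               ≡⟨ sym (*-identityˡ x) ⟩
    1ℚ * x          ≡⟨ cong (_* x) (sym (*-inverseˡ p)) ⟩
    (1/ p * p) * x  ≡⟨ *-assoc (1/ p) p x ⟩
    1/ p * (p * x)  ∎

x≡y+z⇒z≡x-y : ∀ {x y z} → x ≡ y + z → z ≡ x - y
x≡y+z⇒z≡x-y {x} {y} {z} e = trans (solve 2 (λ y z → z := (y :+ z) :- y) refl y z) (cong (_- y) (sym e))

eliminate : ∀ a b c {x y s} → x ≡ y + s → a * s ≡ c * (b * x) → (a - c * b) * x ≡ a * y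
eliminate a b c {x} {y} {s} x≡y+s as≡cbx = begin
  (a - c * b) * x      ≡⟨ solve 4 (λ a b c x → (a :- c :* b) :* x := a :* x :- c :* (b :* x)) refl a b c x ⟩
  a * x - c * (b * x)  ≡⟨ cong (λ t → a * x - t) (sym as≡cbx) ⟩
  a * x - a * s        ≡⟨ cong (λ t → a * t - a * s) x≡y+s ⟩
  a * (y + s) - a * s  ≡⟨ solve 3 (λ a y s → a :* (y :+ s) :- a :* s := a :* y) refl a y s ⟩
  a * y                ∎
  where open ≡-Reasoning

*-sumℚ-map : ∀ {A : Set} (g : A → ℚ) {a b} (xs : List A) →
  (∀ x → a * g x ≡ b) → a * sumℚ (map g xs) ≡ fromℤ (+ length xs) * b
*-sumℚ-map g {a} {b} [] _ = trans (*-zeroʳ a) (sym (*-zeroˡ b))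
*-sumℚ-map g {a} {b} (x ∷ xs) ag≡b = begin
  a * (g x + sumℚ (map g xs))           ≡⟨ solve 3 (λ a u v → a :* (u :+ v) := a :* u :+ a :* v) refl a (g x) (sumℚ (map g xs)) ⟩
  a * g x + a * sumℚ (map g xs)         ≡⟨ cong₂ _+_ (ag≡b x) (*-sumℚ-map g {a} xs ag≡b) ⟩
  b + fromℤ (+ length xs) * b           ≡⟨ solve 2 (λ b n → b :+ n :* b := (con 1ℚ :+ n) :* b) refl b (fromℤ (+ length xs)) ⟩
  (1ℚ + fromℤ (+ length xs)) * b        ≡⟨ cong (_* b) (sym (fromℤ-homo-+ 1ℤ (+ length xs))) ⟩
  fromℤ (+ suc (length xs)) * b         ∎
  where open ≡-Reasoning

P : ℕ → ℕ → ℤ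
P d 0 = 1ℤ
P d 1 = 1ℤ
P d (suc (suc h)) = P d (suc h) ℤ.- + d ℤ.* P d h

P≡1-mod : ∀ d h → Σ[ m ∈ ℤ ] P d h ≡ 1ℤ ℤ.+ + d ℤ.* m
P≡1-mod d 0 = 0ℤ , sym (trans (cong (λ t → 1ℤ ℤ.+ t) (ℤ.*-zeroʳ (+ d))) (ℤ.+-identityʳ 1ℤ))
P≡1-mod d 1 = P≡1-mod d 0
P≡1-mod d (suc (suc h)) with P≡1-mod d (suc h)
... | m , e = m ℤ.- P d h , trans (cong (ℤ._- + d ℤ.* P d h) e) (step (+ d) m (P d h))
  where
  step : ∀ d m p → (1ℤ ℤ.+ d ℤ.* m) ℤ.- d ℤ.* p ≡ 1ℤ ℤ.+ d ℤ.* (m ℤ.- p)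
  step = solve-∀

P≢0 : ∀ {d} → 2 ≤ d → ∀ h → P d h ≢ 0ℤ
P≢0 {d} 2≤d h P≡0 = <⇒≢ 2≤d (sym d≡1)
  where
  m = proj₁ (P≡1-mod d h)
  dm≡-1 : + d ℤ.* m ≡ -1ℤ
  dm≡-1 = trans (unshift (+ d ℤ.* m)) (cong (ℤ._- 1ℤ) (trans (sym (proj₂ (P≡1-mod d h))) P≡0))
    where
    unshift : ∀ x → x ≡ (1ℤ ℤ.+ x) ℤ.- 1ℤ
    unshift = solve-∀
  d≡1 : d ≡ 1
  d≡1 = m*n≡1⇒m≡1 d ∣ m ∣ (trans (sym (ℤ.abs-* (+ d) m)) (cong ∣_∣ dm≡-1))

Pℚ : ℕ → ℕ → ℚ
Pℚ d h = fromℤ (P d h)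

Pℚ-recurrence : ∀ d h → Pℚ d (suc (suc h)) ≡ Pℚ d (suc h) - fromℤ (+ d) * Pℚ d h
Pℚ-recurrence d h = begin
  fromℤ (P d (suc h) ℤ.- + d ℤ.* P d h)        ≡⟨ fromℤ-homo-+ (P d (suc h)) (ℤ.- (+ d ℤ.* P d h)) ⟩
  Pℚ d (suc h) + fromℤ (ℤ.- (+ d ℤ.* P d h))  ≡⟨ cong (λ t → Pℚ d (suc h) + t) (fromℤ-homo‿- (+ d ℤ.* P d h)) ⟩
  Pℚ d (suc h) - fromℤ (+ d ℤ.* P d h)        ≡⟨ cong (λ t → Pℚ d (suc h) - t) (fromℤ-homo-* (+ d) (P d h)) ⟩
  Pℚ d (suc h) - fromℤ (+ d) * Pℚ d h         ∎
  where open ≡-Reasoning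

Pℚ≢0 : ∀ {d} → 2 ≤ d → ∀ h → Pℚ d h ≢ 0ℚ
Pℚ≢0 2≤d h = P≢0 2≤d h ∘ fromℤ-injective

NeighbourSum : (G : Graph) → (V G → ℚ) → Set
NeighbourSum G f = ∀ x → f x ≡ sumℚ (map f (neighbours G x))

module _ {d k : ℕ} where

  depth : LVertex d k → ℕ
  depth = length ∘ proj₁

  children : (w : List (Fin d)) → length w < k → List (LVertex d k)
  children w q = map (λ i → i ∷ w , q) (allFin d)

  LChildren-inner : ∀ {w} (p : length w ≤ k) (q : length w < k) → LChildren (w , p) ≡ children w q
  LChildren-inner {w} p q with length w <? k
  ... | yes q′ = cong (children w) (≤-irrelevant q′ q)
  ... | no q̸  = contradiction q q̸

  LChildren-leaf : ∀ {w} (p : length w ≤ k) → length w ≡ k → LChildren {d} (w , p) ≡ []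
  LChildren-leaf {w} p e with length w <? k
  ... | yes q = contradiction q (<-irrefl e)
  ... | no _  = refl

module Solution {d k} {f : LVertex d k → ℚ} (eqs : NeighbourSum (LevelSymmetricTree d k) f) where

  f-irrelevant : ∀ {w} (p p′ : length w ≤ k) → f (w , p) ≡ f (w , p′)
  f-irrelevant p p′ = cong (λ p → f (_ , p)) (≤-irrelevant p p′)

  root-equation : (q : 0 < k) → f ([] , z≤n) ≡ sumℚ (map f (children [] q))
  root-equation q = trans (eqs _) (cong (sumℚ ∘ map f) (LChildren-inner z≤n q))

  inner-equation : ∀ {i w} (p : suc (length w) ≤ k) (pw : length w ≤ k) (q : suc (length w) < k) →
    f (i ∷ w , p) ≡ f (w , pw) + sumℚ (map f (children (i ∷ w) q))
  inner-equation (s≤s p) pw q =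
    trans (eqs _) (cong₂ _+_ (f-irrelevant _ pw) (cong (sumℚ ∘ map f) (LChildren-inner (s≤s p) q)))

  leaf-equation : ∀ {i w} (p : suc (length w) ≤ k) (pw : length w ≤ k) → suc (length w) ≡ k →
    f (i ∷ w , p) ≡ f (w , pw)
  leaf-equation (s≤s p) pw e = trans (eqs _)
    (trans (cong₂ _+_ (f-irrelevant _ pw) (cong (sumℚ ∘ map f) (LChildren-leaf (s≤s p) e))) (+-identityʳ _))

  *-sum-children : ∀ {w} (q : length w < k) {a b} → (∀ i → a * f (i ∷ w , q) ≡ b) →
    a * sumℚ (map f (children w q)) ≡ fromℤ (+ d) * b
  *-sum-children {w} q {a} {b} H = begin
    a * sumℚ (map f (children w q))                  ≡⟨ cong (λ l → a * sumℚ l) (sym (map-∘ (allFin d))) ⟩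
    a * sumℚ (map (λ i → f (i ∷ w , q)) (allFin d))  ≡⟨ *-sumℚ-map (λ i → f (i ∷ w , q)) {a} (allFin d) H ⟩
    fromℤ (+ length (allFin d)) * b                   ≡⟨ cong (λ n → fromℤ (+ n) * b) (length-tabulate {n = d} (λ i → i)) ⟩
    fromℤ (+ d) * b                                   ∎
    where open ≡-Reasoning

  height-relation : ∀ h {i w} (p : suc (length w) ≤ k) (pw : length w ≤ k) → suc (length w) ℕ.+ h ≡ k →
    Pℚ d (suc h) * f (i ∷ w , p) ≡ Pℚ d h * f (w , pw)
  height-relation zero p pw e = cong (1ℚ *_) (leaf-equation p pw (trans (sym (ℕ.+-identityʳ _)) e))
  height-relation (suc h) {i} {w} p pw e = begin
    Pℚ d (suc (suc h)) * f (i ∷ w , p)                       ≡⟨ cong (_* f (i ∷ w , p)) (Pℚ-recurrence d h) ⟩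
    (Pℚ d (suc h) - fromℤ (+ d) * Pℚ d h) * f (i ∷ w , p)  ≡⟨ eliminate (Pℚ d (suc h)) (Pℚ d h) (fromℤ (+ d))
                                                                  (inner-equation {i} {w} p pw q) children-relation ⟩
    Pℚ d (suc h) * f (w , pw)                                ∎
    where
    open ≡-Reasoning
    e′ : suc (length (i ∷ w)) ℕ.+ h ≡ k
    e′ = trans (sym (+-suc _ h)) e
    q : length (i ∷ w) < k
    q = subst (suc (length (i ∷ w)) ≤_) e′ (m≤m+n _ h)
    children-relation : Pℚ d (suc h) * sumℚ (map f (children (i ∷ w) q)) ≡ fromℤ (+ d) * (Pℚ d h * f (i ∷ w , p))
    children-relation = *-sum-children {i ∷ w} q {Pℚ d (suc h)} (λ j → height-relation h {j} {i ∷ w} q p e′)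

  root-relation : (q : 0 < k) → Pℚ d (suc k) * f ([] , z≤n) ≡ 0ℚ
  root-relation q@(s≤s {n = m} z≤n) = begin
    Pℚ d (suc (suc m)) * f ([] , z≤n)                      ≡⟨ cong (_* f ([] , z≤n)) (Pℚ-recurrence d m) ⟩
    (Pℚ d (suc m) - fromℤ (+ d) * Pℚ d m) * f ([] , z≤n)  ≡⟨ eliminate (Pℚ d (suc m)) (Pℚ d m) (fromℤ (+ d))
                                                                root≡0+children children-relation ⟩
    Pℚ d (suc m) * 0ℚ                                      ≡⟨ *-zeroʳ (Pℚ d (suc m)) ⟩
    0ℚ                                                      ∎
    where
    open ≡-Reasoning
    root≡0+children : f ([] , z≤n) ≡ 0ℚ + sumℚ (map f (children [] q))
    root≡0+children = trans (root-equation q) (sym (+-identityˡ _))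
    children-relation : Pℚ d (suc m) * sumℚ (map f (children [] q)) ≡ fromℤ (+ d) * (Pℚ d m * f ([] , z≤n))
    children-relation = *-sum-children {[]} q {Pℚ d (suc m)} (λ j → height-relation m {j} {[]} q z≤n refl)

  vanishes : (∀ h → Pℚ d h ≢ 0ℚ) → 0 < k → ∀ w p → f (w , p) ≡ 0ℚ
  vanishes Pℚ≢0 q [] z≤n = *-cancelˡ-≡ (Pℚ≢0 (suc k)) (trans (root-relation q) (sym (*-zeroʳ (Pℚ d (suc k)))))
  vanishes Pℚ≢0 q (i ∷ w) p = *-cancelˡ-≡ (Pℚ≢0 (suc h)) (begin
    Pℚ d (suc h) * f (i ∷ w , p)  ≡⟨ height-relation h p pw (m+[n∸m]≡n p) ⟩
    Pℚ d h * f (w , pw)           ≡⟨ cong (Pℚ d h *_) (vanishes Pℚ≢0 q w pw) ⟩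
    Pℚ d h * 0ℚ                   ≡⟨ *-zeroʳ (Pℚ d h) ⟩
    0ℚ                            ≡⟨ sym (*-zeroʳ (Pℚ d (suc h))) ⟩
    Pℚ d (suc h) * 0ℚ             ∎)
    where
    open ≡-Reasoning
    h = k ∸ suc (length w)
    pw = <⇒≤ p

¬NSP-branching : ∀ {d m} → 2 ≤ d → ¬ NeighbourSumProperty (LevelSymmetricTree d (suc m))
¬NSP-branching 2≤d (f , ((w , p) , fw≢0) , eqs) = fw≢0 (vanishes (Pℚ≢0 2≤d) (s≤s z≤n) w p)
  where open Solution eqs

profile : ℕ → ℚ
profile 0 = 1ℚ
profile 1 = 1ℚ
profile 2 = 0ℚ
profile 3 = - 1ℚ
profile 4 = - 1ℚ
profile 5 = 0ℚ
profile (suc (suc (suc (suc (suc (suc n)))))) = profile n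

profile-recurrence : ∀ n → profile (suc n) ≡ profile n + profile (suc (suc n))
profile-recurrence 0 = refl
profile-recurrence 1 = refl
profile-recurrence 2 = refl
profile-recurrence 3 = refl
profile-recurrence 4 = refl
profile-recurrence 5 = refl
profile-recurrence (suc (suc (suc (suc (suc (suc n)))))) = profile-recurrence n

profile-leaf⇔ : ∀ m → (profile (suc m) ≡ profile m) ⇔ (suc m % 3 ≡ 1)
profile-leaf⇔ 0 = mk⇔ (λ _ → refl) (λ _ → refl)
profile-leaf⇔ 1 = mk⇔ (λ ()) (λ ())
profile-leaf⇔ 2 = mk⇔ (λ ()) (λ ())
profile-leaf⇔ 3 = mk⇔ (λ _ → refl) (λ _ → refl)
profile-leaf⇔ 4 = mk⇔ (λ ()) (λ ())
profile-leaf⇔ 5 = mk⇔ (λ ()) (λ ())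
-- `_%_` computes by peeling off `suc`s, so (7 + m) % 3 and (1 + m) % 3 are definitionally equal.
profile-leaf⇔ (suc (suc (suc (suc (suc (suc m)))))) = profile-leaf⇔ m

module Path {k} {f : LVertex 1 k → ℚ} (eqs : NeighbourSum (LevelSymmetricTree 1 k) f) where
  open Solution eqs

  ≡root*profile : ∀ w p → f (w , p) ≡ f ([] , z≤n) * profile (length w)
  ≡root*profile [] z≤n = sym (*-identityʳ _)
  ≡root*profile (zero ∷ []) p = trans (sym (+-identityʳ _)) (trans (sym (root-equation p)) (sym (*-identityʳ _)))
  ≡root*profile (zero ∷ zero ∷ w) p = begin
    f (zero ∷ zero ∷ w , p)              ≡⟨ x≡y+z⇒z≡x-y inner ⟩
    f (zero ∷ w , p′) - f (w , pw)       ≡⟨ cong₂ _-_ (≡root*profile (zero ∷ w) p′) (≡root*profile w pw) ⟩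
    r * profile (suc n) - r * profile n  ≡⟨ solve 3 (λ r a b → r :* a :- r :* b := r :* (a :- b)) refl r (profile (suc n)) (profile n) ⟩
    r * (profile (suc n) - profile n)    ≡⟨ cong (r *_) (sym (x≡y+z⇒z≡x-y (profile-recurrence n))) ⟩
    r * profile (suc (suc n))            ∎
    where
    open ≡-Reasoning
    p′ = <⇒≤ p
    pw = <⇒≤ p′
    r = f ([] , z≤n)
    n = length w
    inner : f (zero ∷ w , p′) ≡ f (w , pw) + f (zero ∷ zero ∷ w , p)
    inner = trans (inner-equation p′ pw p) (cong (λ t → f (w , pw) + t) (+-identityʳ _))

profile-solves : ∀ {m} → suc m % 3 ≡ 1 → NeighbourSum (LevelSymmetricTree 1 (suc m)) (profile ∘ depth)
profile-solves {m} _ ([] , z≤n) = cong (sumℚ ∘ map (profile ∘ depth)) (sym (LChildren-inner {1} {suc m} {[]} z≤n (s≤s z≤n)))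
profile-solves {m} e (i ∷ w , p@(s≤s _)) with m≤n⇒m<n∨m≡n p
... | inj₁ q = begin
  profile (suc n)                                                ≡⟨ profile-recurrence n ⟩
  profile n + profile (suc (suc n))                              ≡⟨ cong (λ t → profile n + t) (sym (+-identityʳ _)) ⟩
  profile n + sumℚ (map (profile ∘ depth) (children (i ∷ w) q))  ≡⟨ cong (λ l → profile n + sumℚ (map (profile ∘ depth) l))
                                                                       (sym (LChildren-inner p q)) ⟩
  profile n + sumℚ (map (profile ∘ depth) (LChildren (i ∷ w , p)))  ∎
  where
  open ≡-Reasoning
  n = length w
... | inj₂ leaf = begin
  profile (suc n)                                                ≡⟨ subst (λ n → profile (suc n) ≡ profile n)
                                                                       (sym (suc-injective leaf)) (Equivalence.from (profile-leaf⇔ m) e) ⟩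
  profile n                                                      ≡⟨ sym (+-identityʳ _) ⟩
  profile n + 0ℚ                                                 ≡⟨ cong (λ l → profile n + sumℚ (map (profile ∘ depth) l))
                                                                       (sym (LChildren-leaf p leaf)) ⟩
  profile n + sumℚ (map (profile ∘ depth) (LChildren (i ∷ w , p)))  ∎
  where
  open ≡-Reasoning
  n = length w

NSP-path⇔ : ∀ m → NeighbourSumProperty (LevelSymmetricTree 1 (suc m)) ⇔ (suc m % 3 ≡ 1)
NSP-path⇔ m = mk⇔ necessary sufficient
  where
  sufficient : suc m % 3 ≡ 1 → NeighbourSumProperty (LevelSymmetricTree 1 (suc m))
  sufficient e = profile ∘ depth , (([] , z≤n) , λ ()) , profile-solves e

  necessary : NeighbourSumProperty (LevelSymmetricTree 1 (suc m)) → suc m % 3 ≡ 1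
  necessary (f , ((x , px) , fx≢0) , eqs) = Equivalence.to (profile-leaf⇔ m) (*-cancelˡ-≡ r≢0 leaf)
    where
    open Solution eqs
    open Path eqs
    open ≡-Reasoning
    r = f ([] , z≤n)
    r≢0 : r ≢ 0ℚ
    r≢0 r≡0 = fx≢0 (begin
      f (x , px)                ≡⟨ ≡root*profile x px ⟩
      r * profile (length x)    ≡⟨ cong (_* profile (length x)) r≡0 ⟩
      0ℚ * profile (length x)   ≡⟨ *-zeroˡ (profile (length x)) ⟩
      0ℚ                        ∎)
    u = replicate m zero
    |u|≡m : length u ≡ m
    |u|≡m = length-replicate m
    pl : suc (length u) ≤ suc m
    pl = s≤s (≤-reflexive |u|≡m)
    pu = <⇒≤ pl
    leaf : r * profile (suc m) ≡ r * profile m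
    leaf = begin
      r * profile (suc m)           ≡⟨ cong (λ n → r * profile (suc n)) (sym |u|≡m) ⟩
      r * profile (suc (length u))  ≡⟨ sym (≡root*profile (zero ∷ u) pl) ⟩
      f (zero ∷ u , pl)             ≡⟨ leaf-equation pl pu (cong suc |u|≡m) ⟩
      f (u , pu)                    ≡⟨ ≡root*profile u pu ⟩
      r * profile (length u)        ≡⟨ cong (λ n → r * profile n) |u|≡m ⟩
      r * profile m                 ∎

proposition3p4 : (d k : ℕ) → 1 ≤ d → 1 ≤ k →
    (NeighbourSumProperty (LevelSymmetricTree d k) ⇔ (d ≡ 1 × k % 3 ≡ 1))
proposition3p4 zero          _       ()  _
proposition3p4 _             zero    _   ()
proposition3p4 (suc zero)    (suc m) _   _ = mk⇔ (λ nsp → refl , to nsp) (from ∘ proj₂)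
  where open Equivalence (NSP-path⇔ m)
proposition3p4 (suc (suc d)) (suc m) _   _ = mk⇔ (⊥-elim ∘ ¬NSP-branching (s≤s (s≤s z≤n))) λ { (() , _) }
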